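{- Let $\mathcal Z$ be a commutative associative unital $\mathbb Q$-algebra, $N\in\mathbb N$, $n\in[N]$, $z_j\in\mathcal Z$ for $j\in[N]$, and $\widetilde z=\frac1N\sum_{j=1}^Nz_j$. For $A\subseteq[N]$ and $k\in\mathbb Z$ let $E_{A,k}=\sum_{J\subseteq A,\,|J|=k}\prod_{j\in J}z_j$. Then $$\frac1{\binom Nn}E_{[N],n}-\widetilde z^{\,n}=-\frac1{2N}\sum_{(u,v)\in[N]^2_{\neq}}(z_u-z_v)^2\sum_{k=2}^n\frac{\widetilde z^{\,n-k}}{k\binom Nk}E_{[N]\setminus\{u,v\},k-2}.$$ In particular, for $n=N$, $$\prod_{j=1}^nz_j-\widetilde z^{\,n}=-\frac1{2n}\sum_{(u,v)\in[n]^2_{\neq}}(z_u-z_v)^2\sum_{k=2}^n\frac{\widetilde z^{\,n-k}}{k\binom nk}E_{[n]\setminus\{u,v\},k-2}.$$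
   Context: $[m]=\{1,\dots,m\}$; $[N]^2_{\neq}=\{(u,v)\in[N]^2:u\ne v\}$. $E_{A,0}=1$ and $E_{A,k}=0$ for $k<0$ or $k>|A|$. Empty sums are $0$; $\widetilde z^{\,0}=1$. -}

module Defs where

open import Level using (Level)
open import Data.Bool using (Bool; if_then_else_)
open import Data.Nat as ℕ using (ℕ; zero; suc)
open import Data.Integer using (+_)
open import Data.Rational using (ℚ; _/_)
open import Data.Fin as Fin using (Fin)
open import Data.Fin.Subset using (Subset; inside; outside; ∣_∣; ⁅_⁆; _∪_; ∁; ⊤; _⊆_)
open import Data.Fin.Subset.Properties using (_⊆?_)
open import Data.Vec using (Vec; []; _∷_; lookup)
open import Data.List using (List; []; _∷_; [_]; map; _++_; filter; allFin; concatMap; foldr)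
open import Data.Product using (_×_; _,_; proj₁; proj₂)
open import Relation.Nullary using (¬?; does)
open import Relation.Nullary.Decidable using (_×-dec_)
open import Algebra.Bundles using (CommutativeRing)

-- 1/m as a rational number for m ≥ 1 (junk value 0 for m = 0; never used
-- at m = 0 in the statement, since all denominators there are positive).
inv : ℕ → ℚ
inv zero    = + 0 / 1
inv (suc m) = + 1 / suc m

allSubsets : (N : ℕ) → List (Subset N)
allSubsets zero    = [ [] ]
allSubsets (suc N) = map (outside ∷_) (allSubsets N) ++ map (inside ∷_) (allSubsets N)

offDiagPairs : (N : ℕ) → List (Fin N × Fin N)
offDiagPairs N =
  filter (λ p → ¬? (proj₁ p Fin.≟ proj₂ p))
         (concatMap (λ u → map (λ v → (u , v)) (allFin N)) (allFin N))

rangeFromTo : ℕ → ℕ → List ℕ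
rangeFromTo a b = map (λ i → i ℕ.+ a) (Data.List.upTo (suc b ℕ.∸ a))
  where import Data.List

module Ops {c ℓ : Level} (R : CommutativeRing c ℓ) where
  open CommutativeRing R

  _−_ : Carrier → Carrier → Carrier
  x − y = x + (- y)

  _^_ : Carrier → ℕ → Carrier
  x ^ zero  = 1#
  x ^ suc m = x * (x ^ m)

  sumL : List Carrier → Carrier
  sumL = foldr _+_ 0#

  prodAll : {N : ℕ} → (Fin N → Carrier) → Carrier
  prodAll {N} z = foldr (λ j acc → z j * acc) 1# (allFin N)

  prodOver : {N : ℕ} → (Fin N → Carrier) → Subset N → Carrier
  prodOver {N} z J = foldr (λ j acc → (if lookup J j then z j else 1#) * acc) 1# (allFin N)

  E : {N : ℕ} → (Fin N → Carrier) → Subset N → ℕ → Carrier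
  E {N} z A k =
    sumL (map (prodOver z)
      (filter (λ J → (J ⊆? A) ×-dec (∣ J ∣ ℕ.≟ k)) (allSubsets N)))

module Submission where

-- Let e_j be the elementary symmetric polynomials of z, S = Σ z_j = N z̃, and
-- T_j = z̃^(n−j) e_j / C(N,j), so that T_1 = z̃^n and T_n = E_{[N],n} / C(N,n). Expanding the square and
-- using Σ_u z_u e_m(z ∖ u) = (m+1) e_{m+1} and Σ_u e_m(z ∖ u) = (N−m) e_m gives
--   Σ_{u,v} (z_u − z_v)² e_{k−2}(z ∖ {u,v}) = 2 (N−k+1) S e_{k−1} − 2 k N e_k,
-- and with k C(N,k) = (N−k+1) C(N,k−1) the k-th term of the right-hand side becomes T_k − T_{k−1}.
-- The sum over k telescopes to T_n − T_1. Variables are removed from z by setting them to 0 (zeroAt).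

open import Defs
open import Data.Nat using (ℕ; _≤_; _∸_) renaming (_*_ to _*ℕ_)
open import Data.Nat.Combinatorics using (_C_)
open import Data.Rational using (ℚ)
open import Data.Rational.Properties using (+-*-commutativeRing)
open import Data.Fin using (Fin)
open import Data.Fin.Subset using (⁅_⁆; _∪_; ∁; ⊤)
open import Data.List using (map; allFin)
open import Data.Product using (_×_; _,_)
open import Algebra.Bundles using (CommutativeRing)
open import Algebra.Morphism.Structures using (IsRingHomomorphism)

open import Data.Bool using (Bool; true; false; if_then_else_; not; _∨_)
open import Data.Fin as Fin using (zero; suc)
open import Data.Fin.Subset using (Subset; inside; outside; ∣_∣; _⊆_)
open import Data.Fin.Subset.Properties using (_⊆?_; out⊆-⇔; in⊆in-⇔)
open import Data.Integer as ℤ using (+_)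
import Data.Integer.Properties as ℤ
open import Data.List using (List; []; _∷_; _++_; filter; foldr; tabulate; concatMap; applyUpTo)
import Data.List.Properties as List
open import Data.Maybe using (Maybe; just; nothing)
open import Data.Nat as ℕ using (zero; suc; s≤s; z≤n; _<_) renaming (_+_ to _+ℕ_)
open import Data.Nat.Combinatorics using (nCk+nC[k+1]≡[n+1]C[k+1]; k>n⇒nCk≡0; nC1≡n; nCn≡1)
import Data.Nat.Properties as ℕ
open import Data.Nat.Tactic.RingSolver using (solve-∀)
open import Data.Product using (proj₁; proj₂)
open import Data.Product.Function.NonDependent.Propositional using (_×-⇔_)
open import Data.Rational as ℚ using (0ℚ; 1ℚ; toℚᵘ)
open import Data.Rational.Properties using (toℚᵘ-injective; toℚᵘ-homo-*; toℚᵘ-homo-+; toℚᵘ-fromℚᵘ)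
open import Data.Rational.Unnormalised as ℚᵘ using (mkℚᵘ; *≡*)
import Data.Rational.Unnormalised.Properties as ℚᵘ
open import Data.Vec using ([]; _∷_; lookup; here)
import Data.Vec.Properties as Vec
open import Data.Vec.Functional as Vector using (Vector; head; tail; updateAt)
open import Data.Vec.Functional.Properties using (updateAt-updateAt-local; updateAt-commutes)
open import Function using (_∘_; id; const; case_of_; mk⇔)
open import Function.Construct.Identity using (⇔-id)
open import Relation.Binary.PropositionalEquality as ≡ using (_≡_; _≗_)
open import Relation.Nullary using (yes; no; does; ¬?)
open import Relation.Nullary.Decidable using (_×-dec_; does-⇔; dec-false)
open import Relation.Unary using (Decidable)
import Algebra.Solver.Ring
import Algebra.Solver.Ring.AlmostCommutativeRing as ACR

natQ : ℕ → ℚ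
natQ zero    = 0ℚ
natQ (suc n) = 1ℚ ℚ.+ natQ n

toℚᵘ-natQ : ∀ n → toℚᵘ (natQ n) ℚᵘ.≃ mkℚᵘ (+ n) 0
toℚᵘ-natQ zero    = ℚᵘ.≃-refl
toℚᵘ-natQ (suc n) = ℚᵘ.≃-trans (toℚᵘ-homo-+ 1ℚ (natQ n)) (ℚᵘ.≃-trans (ℚᵘ.+-congʳ _ (toℚᵘ-natQ n)) 1+n≃suc-n)
  where
  1+n≃suc-n : mkℚᵘ (+ 1) 0 ℚᵘ.+ mkℚᵘ (+ n) 0 ℚᵘ.≃ mkℚᵘ (+ suc n) 0
  1+n≃suc-n = *≡* (≡.cong (λ x → (+ 1 ℤ.+ x) ℤ.* + 1) (ℤ.*-identityʳ (+ n)))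

inv-*-natQ : ∀ m → inv (suc m) ℚ.* natQ (suc m) ≡ 1ℚ
inv-*-natQ m = toℚᵘ-injective (ℚᵘ.≃-trans (toℚᵘ-homo-* (inv (suc m)) (natQ (suc m)))
  (ℚᵘ.≃-trans (ℚᵘ.*-cong (toℚᵘ-fromℚᵘ (mkℚᵘ (+ 1) m)) (toℚᵘ-natQ (suc m))) 1/suc-m*suc-m≃1))
  where
  1/suc-m*suc-m≃1 : mkℚᵘ (+ 1) m ℚᵘ.* mkℚᵘ (+ suc m) 0 ℚᵘ.≃ mkℚᵘ (+ 1) 0
  1/suc-m*suc-m≃1 = *≡* (≡.trans (ℤ.*-identityʳ _) (≡.trans (ℤ.*-identityˡ (+ suc m))
    (≡.sym (≡.trans (ℤ.*-identityˡ _) (≡.cong (λ x → + suc x) (ℕ.*-identityʳ m))))))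

C-pos : ∀ {n k} → k ≤ n → 1 ≤ n C k
C-pos {n}     {zero}  _         = s≤s z≤n
C-pos {suc n} {suc k} (s≤s k≤n) rewrite ≡.sym (nCk+nC[k+1]≡[n+1]C[k+1] n k) =
  ℕ.≤-trans (C-pos k≤n) (ℕ.m≤m+n (n C k) (n C suc k))

C-absorption : ∀ N k → suc k *ℕ (N C suc k) ≡ (N ∸ k) *ℕ (N C k)
C-absorption N k = ≡.sym (≡.trans (ℕ.*-distribʳ-∸ (N C k) N k)
  (≡.trans (≡.cong (_∸ k *ℕ (N C k)) (≡.sym (absorption N k))) (ℕ.m+n∸n≡m _ (k *ℕ (N C k)))))
  where
  absorption : ∀ N k → suc k *ℕ (N C suc k) +ℕ k *ℕ (N C k) ≡ N *ℕ (N C k)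
  absorption zero    zero    = ≡.refl
  absorption zero    (suc k) rewrite k>n⇒nCk≡0 {0} {suc (suc k)} (s≤s z≤n) | k>n⇒nCk≡0 {0} {suc k} (s≤s z≤n) =
    ≡.cong₂ _+ℕ_ (ℕ.*-zeroʳ (suc (suc k))) (ℕ.*-zeroʳ (suc k))
  absorption (suc N) zero    rewrite nC1≡n (suc N) =
    ≡.trans (ℕ.+-identityʳ _) (≡.trans (ℕ.*-identityˡ (suc N)) (≡.sym (ℕ.*-identityʳ (suc N))))
  absorption (suc N) (suc k)
    rewrite ≡.sym (nCk+nC[k+1]≡[n+1]C[k+1] N (suc k)) | ≡.sym (nCk+nC[k+1]≡[n+1]C[k+1] N k) =
    ≡.trans (regroup k (N C k) (N C suc k) (N C suc (suc k)))
      (≡.trans (≡.cong₂ (λ x y → x +ℕ y +ℕ (N C k +ℕ N C suc k)) (absorption N (suc k)) (absorption N k))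
               (collect N (N C k) (N C suc k)))
    where
    regroup : ∀ k a b c → suc (suc k) *ℕ (b +ℕ c) +ℕ suc k *ℕ (a +ℕ b)
            ≡ (suc (suc k) *ℕ c +ℕ suc k *ℕ b) +ℕ (suc k *ℕ b +ℕ k *ℕ a) +ℕ (a +ℕ b)
    regroup = solve-∀
    collect : ∀ N a b → N *ℕ b +ℕ N *ℕ a +ℕ (a +ℕ b) ≡ suc N *ℕ (a +ℕ b)
    collect = solve-∀

module QAlgebra {ℓ₁ ℓ₂} (R : CommutativeRing ℓ₁ ℓ₂) (ι : ℚ → CommutativeRing.Carrier R)
  (ι-hom : IsRingHomomorphism (CommutativeRing.rawRing +-*-commutativeRing) (CommutativeRing.rawRing R) ι) where

  open CommutativeRing R hiding (zero)
  open Ops R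
  open import Algebra.Properties.Semiring.Sum semiring
    using (sum; sum-syntax; sum-cong-≋; sum-cong-≗; ∑-distrib-+; ∑-comm; *-distribˡ-sum)
  open import Algebra.Properties.CommutativeSemigroup *-commutativeSemigroup using (x∙yz≈y∙xz)
  open import Relation.Binary.Reasoning.Setoid setoid
  module ι = IsRingHomomorphism ι-hom

  private
    ι-morphism : CommutativeRing.rawRing +-*-commutativeRing ACR.-Raw-AlmostCommutative⟶ ACR.fromCommutativeRing R
    ι-morphism = record
      { ⟦_⟧ = ι ; +-homo = ι.+-homo ; *-homo = ι.*-homo ; -‿homo = ι.-‿homo ; 0-homo = ι.0#-homo ; 1-homo = ι.1#-homo }

    ι-≟ : ∀ p q → Maybe (ι p ≈ ι q)
    ι-≟ p q with p ℚ.≟ q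
    ... | yes p≡q = just (reflexive (≡.cong ι p≡q))
    ... | no _    = nothing

  open Algebra.Solver.Ring (CommutativeRing.rawRing +-*-commutativeRing) (ACR.fromCommutativeRing R) ι-morphism ι-≟
    using (solve; _:=_; _:+_; _:*_; :-_; _:-_; con)

  fromℕ : ℕ → Carrier
  fromℕ n = ι (natQ n)

  fromℕ-suc : ∀ n → fromℕ (suc n) ≈ ι 1ℚ + fromℕ n
  fromℕ-suc n = ι.+-homo 1ℚ (natQ n)

  fromℕ-+ : ∀ a b → fromℕ (a +ℕ b) ≈ fromℕ a + fromℕ b
  fromℕ-+ zero    b = solve 1 (λ x → x := con 0ℚ :+ x) refl (fromℕ b)
  fromℕ-+ (suc a) b = begin
    fromℕ (suc (a +ℕ b))          ≈⟨ fromℕ-suc (a +ℕ b) ⟩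
    ι 1ℚ + fromℕ (a +ℕ b)         ≈⟨ +-congˡ (fromℕ-+ a b) ⟩
    ι 1ℚ + (fromℕ a + fromℕ b)   ≈⟨ sym (+-assoc _ _ _) ⟩
    (ι 1ℚ + fromℕ a) + fromℕ b   ≈⟨ +-congʳ (sym (fromℕ-suc a)) ⟩
    fromℕ (suc a) + fromℕ b      ∎

  fromℕ-* : ∀ a b → fromℕ (a *ℕ b) ≈ fromℕ a * fromℕ b
  fromℕ-* zero    b = solve 1 (λ x → con 0ℚ := con 0ℚ :* x) refl (fromℕ b)
  fromℕ-* (suc a) b = begin
    fromℕ (b +ℕ a *ℕ b)              ≈⟨ fromℕ-+ b (a *ℕ b) ⟩
    fromℕ b + fromℕ (a *ℕ b)        ≈⟨ +-congˡ (fromℕ-* a b) ⟩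
    fromℕ b + fromℕ a * fromℕ b     ≈⟨ solve 2 (λ x y → y :+ x :* y := (con 1ℚ :+ x) :* y) refl (fromℕ a) (fromℕ b) ⟩
    (ι 1ℚ + fromℕ a) * fromℕ b      ≈⟨ *-congʳ (sym (fromℕ-suc a)) ⟩
    fromℕ (suc a) * fromℕ b         ∎

  recip : ℕ → Carrier
  recip n = ι (inv n)

  recip-*-fromℕ : ∀ {n} → 1 ≤ n → recip n * fromℕ n ≈ 1#
  recip-*-fromℕ {suc m} _ = trans (sym (ι.*-homo (inv (suc m)) (natQ (suc m))))
                                  (trans (reflexive (≡.cong ι (inv-*-natQ m))) ι.1#-homo)

  inverse-unique : ∀ {x y a} → x * a ≈ 1# → y * a ≈ 1# → x ≈ y
  inverse-unique {x} {y} {a} xa≈1 ya≈1 = begin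
    x               ≈⟨ sym (*-identityʳ x) ⟩
    x * 1#          ≈⟨ *-congˡ (sym ya≈1) ⟩
    x * (y * a)     ≈⟨ solve 3 (λ x y a → x :* (y :* a) := y :* (x :* a)) refl x y a ⟩
    y * (x * a)     ≈⟨ *-congˡ xa≈1 ⟩
    y * 1#          ≈⟨ *-identityʳ y ⟩
    y               ∎

  recip-* : ∀ {a b} → 1 ≤ a → 1 ≤ b → recip (a *ℕ b) ≈ recip a * recip b
  recip-* {a} {b} 1≤a 1≤b = inverse-unique (recip-*-fromℕ (ℕ.*-mono-≤ 1≤a 1≤b)) (begin
    (recip a * recip b) * fromℕ (a *ℕ b)           ≈⟨ *-congˡ (fromℕ-* a b) ⟩
    (recip a * recip b) * (fromℕ a * fromℕ b)
      ≈⟨ solve 4 (λ p q x y → (p :* q) :* (x :* y) := (p :* x) :* (q :* y)) refl (recip a) (recip b) (fromℕ a) (fromℕ b) ⟩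
    (recip a * fromℕ a) * (recip b * fromℕ b)      ≈⟨ *-cong (recip-*-fromℕ 1≤a) (recip-*-fromℕ 1≤b) ⟩
    1# * 1#                                        ≈⟨ *-identityˡ 1# ⟩
    1#                                             ∎)

  recip-*-fromℕ-cancel : ∀ {a b d} → 1 ≤ a → 1 ≤ d → a ≡ b *ℕ d → recip a * fromℕ b ≈ recip d
  recip-*-fromℕ-cancel {a} {b} {d} 1≤a 1≤d a≡bd = inverse-unique (begin
    (recip a * fromℕ b) * fromℕ d   ≈⟨ *-assoc _ _ _ ⟩
    recip a * (fromℕ b * fromℕ d)   ≈⟨ *-congˡ (sym (fromℕ-* b d)) ⟩
    recip a * fromℕ (b *ℕ d)        ≈⟨ *-congˡ (reflexive (≡.cong fromℕ (≡.sym a≡bd))) ⟩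
    recip a * fromℕ a               ≈⟨ recip-*-fromℕ 1≤a ⟩
    1#                              ∎) (recip-*-fromℕ 1≤d)

  ∑-distrib-− : ∀ {N} (f g : Vector Carrier N) → ∑[ j < N ] (f j − g j) ≈ sum f − sum g
  ∑-distrib-− {zero}  f g = sym (-‿inverseʳ 0#)
  ∑-distrib-− {suc N} f g = trans (+-congˡ (∑-distrib-− (tail f) (tail g)))
    (solve 4 (λ a b c d → (a :- b) :+ (c :- d) := (a :+ c) :- (b :+ d)) refl (head f) (head g) (sum (tail f)) (sum (tail g)))

  -- Elementary symmetric polynomials

  zeroAt : ∀ {N} → Fin N → Vector Carrier N → Vector Carrier N
  zeroAt u w = updateAt w u (const 0#)

  sum-zeroAt : ∀ {N} u (f : Vector Carrier N) → sum f ≈ sum (zeroAt u f) + f u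
  sum-zeroAt zero    f = trans (+-comm _ _) (+-congʳ (sym (+-identityˡ _)))
  sum-zeroAt (suc u) f = trans (+-congˡ (sum-zeroAt u (tail f))) (sym (+-assoc _ _ _))

  zeroAt-*ˡ : ∀ {N} u (w x : Vector Carrier N) v → zeroAt u w v * x v ≈ zeroAt u (λ j → w j * x j) v
  zeroAt-*ˡ zero    w x zero    = zeroˡ (x zero)
  zeroAt-*ˡ zero    w x (suc v) = refl
  zeroAt-*ˡ (suc u) w x zero    = refl
  zeroAt-*ˡ (suc u) w x (suc v) = zeroAt-*ˡ u (tail w) (tail x) v

  zeroAt-idem : ∀ {N} u (w : Vector Carrier N) → zeroAt u (zeroAt u w) ≗ zeroAt u w
  zeroAt-idem u w = updateAt-updateAt-local u w ≡.refl

  zeroAt-comm : ∀ {N} u v (w : Vector Carrier N) → zeroAt v (zeroAt u w) ≗ zeroAt u (zeroAt v w)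
  zeroAt-comm u v w with u Fin.≟ v
  ... | yes ≡.refl = λ _ → ≡.refl
  ... | no u≢v     = updateAt-commutes v u (u≢v ∘ ≡.sym) w

  e : ∀ {N} → Vector Carrier N → ℕ → Carrier
  e w       zero    = 1#
  e {zero}  w (suc k) = 0#
  e {suc N} w (suc k) = e (tail w) (suc k) + head w * e (tail w) k

  e-cong : ∀ {N} {w w′ : Vector Carrier N} → (∀ j → w j ≈ w′ j) → ∀ k → e w k ≈ e w′ k
  e-cong           w≋w′ zero    = refl
  e-cong {zero}    w≋w′ (suc k) = refl
  e-cong {suc N}   w≋w′ (suc k) = +-cong (e-cong (w≋w′ ∘ suc) (suc k)) (*-cong (w≋w′ zero) (e-cong (w≋w′ ∘ suc) k))

  e-head-zero : ∀ {N} (w : Vector Carrier (suc N)) → head w ≈ 0# → ∀ k → e w k ≈ e (tail w) k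
  e-head-zero w w₀≈0 zero    = refl
  e-head-zero w w₀≈0 (suc k) = trans (+-congˡ (trans (*-congʳ w₀≈0) (zeroˡ _))) (+-identityʳ _)

  e-1 : ∀ {N} (w : Vector Carrier N) → e w 1 ≈ sum w
  e-1 {zero}  w = refl
  e-1 {suc N} w = trans (+-cong (e-1 (tail w)) (*-identityʳ (head w))) (+-comm _ _)

  e-vanishes : ∀ {N} (w : Vector Carrier N) k → N < k → e w k ≈ 0#
  e-vanishes {zero}  w (suc k) _         = refl
  e-vanishes {suc N} w (suc k) (s≤s N<k) =
    trans (+-cong (e-vanishes (tail w) (suc k) (ℕ.m≤n⇒m≤1+n N<k)) (trans (*-congˡ (e-vanishes (tail w) k N<k)) (zeroʳ _)))
          (+-identityʳ 0#)

  product : ∀ {N} → Vector Carrier N → Carrier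
  product = Vector.foldr _*_ 1#

  e-top : ∀ {N} (w : Vector Carrier N) → e w N ≈ product w
  e-top {zero}  w = refl
  e-top {suc N} w = trans (+-cong (e-vanishes (tail w) (suc N) (ℕ.n<1+n N)) (*-congˡ (e-top (tail w)))) (+-identityˡ _)

  e-zeroAt : ∀ {N} (w : Vector Carrier N) u m → e w (suc m) ≈ e (zeroAt u w) (suc m) + w u * e (zeroAt u w) m
  e-zeroAt w zero m = sym (+-cong (e-head-zero (zeroAt zero w) refl (suc m)) (*-congˡ (e-head-zero (zeroAt zero w) refl m)))
  e-zeroAt w (suc u) zero = begin
    e (tail w) 1 + w zero * 1#                      ≈⟨ +-congʳ (e-zeroAt (tail w) u zero) ⟩
    (e w′ 1 + w (suc u) * 1#) + w zero * 1#
      ≈⟨ solve 4 (λ a x y o → (a :+ x :* o) :+ y :* o := (a :+ y :* o) :+ x :* o) refl (e w′ 1) (w (suc u)) (w zero) 1# ⟩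
    (e w′ 1 + w zero * 1#) + w (suc u) * 1#         ∎
    where w′ = zeroAt u (tail w)
  e-zeroAt w (suc u) (suc m) = begin
    e (tail w) (suc (suc m)) + w zero * e (tail w) (suc m)
      ≈⟨ +-cong (e-zeroAt (tail w) u (suc m)) (*-congˡ (e-zeroAt (tail w) u m)) ⟩
    (e w′ (suc (suc m)) + x * e w′ (suc m)) + y * (e w′ (suc m) + x * e w′ m)
      ≈⟨ solve 5 (λ A B C x y → (A :+ x :* B) :+ y :* (B :+ x :* C) := (A :+ y :* B) :+ x :* (B :+ y :* C)) refl
           (e w′ (suc (suc m))) (e w′ (suc m)) (e w′ m) x y ⟩
    (e w′ (suc (suc m)) + y * e w′ (suc m)) + x * (e w′ (suc m) + y * e w′ m) ∎
    where w′ = zeroAt u (tail w)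
          x  = w (suc u)
          y  = w zero

  ∑-*-e-zeroAt : ∀ {N} (w : Vector Carrier N) m → ∑[ u < N ] (w u * e (zeroAt u w) m) ≈ fromℕ (suc m) * e w (suc m)
  ∑-*-e-zeroAt {zero}  w m    = sym (zeroʳ _)
  ∑-*-e-zeroAt {suc N} w zero = begin
    w zero * 1# + ∑[ u < N ] (w (suc u) * 1#)   ≈⟨ +-congˡ (∑-*-e-zeroAt (tail w) zero) ⟩
    w zero * 1# + fromℕ 1 * e (tail w) 1
      ≈⟨ solve 3 (λ x a o → x :* o :+ con (natQ 1) :* a := con (natQ 1) :* (a :+ x :* o)) refl (w zero) (e (tail w) 1) 1# ⟩
    fromℕ 1 * (e (tail w) 1 + w zero * 1#)      ∎
  ∑-*-e-zeroAt {suc N} w (suc m) = begin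
    w zero * e (zeroAt zero w) (suc m) + ∑[ u < N ] (w (suc u) * (e (w′ u) (suc m) + x * e (w′ u) m))
      ≈⟨ +-cong (*-congˡ (e-head-zero (zeroAt zero w) refl (suc m)))
                (trans (sum-cong-≋ {N} λ u → distribˡ _ _ _) (∑-distrib-+ {N} _ _)) ⟩
    x * a + (∑[ u < N ] (w (suc u) * e (w′ u) (suc m)) + ∑[ u < N ] (w (suc u) * (x * e (w′ u) m)))
      ≈⟨ +-congˡ (+-cong (∑-*-e-zeroAt (tail w) (suc m))
           (trans (sum-cong-≋ {N} λ u → x∙yz≈y∙xz (w (suc u)) x (e (w′ u) m))
             (trans (sym (*-distribˡ-sum {N} x _)) (*-congˡ (∑-*-e-zeroAt (tail w) m))))) ⟩
    x * a + (fromℕ (suc (suc m)) * b + x * (fromℕ (suc m) * a))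
      ≈⟨ +-congˡ (+-congʳ (*-congʳ (fromℕ-suc (suc m)))) ⟩
    x * a + ((ι 1ℚ + fromℕ (suc m)) * b + x * (fromℕ (suc m) * a))
      ≈⟨ solve 4 (λ x a b p → x :* a :+ ((con 1ℚ :+ p) :* b :+ x :* (p :* a)) := (con 1ℚ :+ p) :* (b :+ x :* a))
                 refl x a b (fromℕ (suc m)) ⟩
    (ι 1ℚ + fromℕ (suc m)) * (b + x * a)
      ≈⟨ *-congʳ (sym (fromℕ-suc (suc m))) ⟩
    fromℕ (suc (suc m)) * (b + x * a) ∎
    where w′ = λ u → zeroAt u (tail w)
          x  = w zero
          a  = e (tail w) (suc m)
          b  = e (tail w) (suc (suc m))

  ∑-e-zeroAt : ∀ {N} (w : Vector Carrier N) m → ∑[ u < N ] e (zeroAt u w) m + fromℕ m * e w m ≈ fromℕ N * e w m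
  ∑-e-zeroAt {zero}  w zero    = +-identityˡ _
  ∑-e-zeroAt {zero}  w (suc m) = trans (+-identityˡ _) (trans (zeroʳ _) (sym (zeroʳ _)))
  ∑-e-zeroAt {suc N} w zero    = begin
    (1# + ∑[ u < N ] 1#) + fromℕ 0 * 1#   ≈⟨ +-assoc _ _ _ ⟩
    1# + (∑[ u < N ] 1# + fromℕ 0 * 1#)   ≈⟨ +-cong (sym ι.1#-homo) (trans (∑-e-zeroAt (tail w) zero) (*-identityʳ _)) ⟩
    ι 1ℚ + fromℕ N                        ≈⟨ sym (trans (*-identityʳ _) (fromℕ-suc N)) ⟩
    fromℕ (suc N) * 1#                    ∎
  ∑-e-zeroAt {suc N} w (suc m) = begin
    (e (zeroAt zero w) (suc m) + ∑[ u < N ] (e (w′ u) (suc m) + x * e (w′ u) m)) + p * (a + x * b)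
      ≈⟨ +-congʳ (+-cong (e-head-zero (zeroAt zero w) refl (suc m))
                         (trans (∑-distrib-+ {N} _ _) (+-congˡ (sym (*-distribˡ-sum {N} x _))))) ⟩
    (a + (X + x * Y)) + p * (a + x * b)
      ≈⟨ solve 6 (λ a X x Y p b → (a :+ (X :+ x :* Y)) :+ p :* (a :+ x :* b) := a :+ (X :+ p :* a) :+ x :* (Y :+ p :* b))
                 refl a X x Y p b ⟩
    a + (X + p * a) + x * (Y + p * b)
      ≈⟨ +-cong (+-congˡ (∑-e-zeroAt (tail w) (suc m))) (*-congˡ (+-congˡ (*-congʳ (fromℕ-suc m)))) ⟩
    a + q * a + x * (Y + (ι 1ℚ + fromℕ m) * b)
      ≈⟨ solve 6 (λ a q x Y r b → a :+ q :* a :+ x :* (Y :+ (con 1ℚ :+ r) :* b) := a :+ q :* a :+ x :* (Y :+ r :* b) :+ x :* b)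
                 refl a q x Y (fromℕ m) b ⟩
    a + q * a + x * (Y + fromℕ m * b) + x * b
      ≈⟨ +-congʳ (+-congˡ (*-congˡ (∑-e-zeroAt (tail w) m))) ⟩
    a + q * a + x * (q * b) + x * b
      ≈⟨ solve 4 (λ a q x b → a :+ q :* a :+ x :* (q :* b) :+ x :* b := (con 1ℚ :+ q) :* (a :+ x :* b)) refl a q x b ⟩
    (ι 1ℚ + q) * (a + x * b)
      ≈⟨ *-congʳ (sym (fromℕ-suc N)) ⟩
    fromℕ (suc N) * (a + x * b) ∎
    where w′ = λ u → zeroAt u (tail w)
          x  = w zero
          a  = e (tail w) (suc m)
          b  = e (tail w) m
          X  = ∑[ u < N ] e (w′ u) (suc m)
          Y  = ∑[ u < N ] e (w′ u) m
          p  = fromℕ (suc m)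
          q  = fromℕ N

  ^2≈* : ∀ x → (x ^ 2) ≈ x * x
  ^2≈* x = *-congˡ (*-identityʳ x)

  module _ {N} (z : Vector Carrier N) (m : ℕ) where

    ∑-sq-e-zeroAt : ∑[ u < N ] (z u * z u * e (zeroAt u z) m)
                  ≈ (sum z * e z (suc m)) − (fromℕ (suc (suc m)) * e z (suc (suc m)))
    ∑-sq-e-zeroAt = begin
      ∑[ u < N ] (z u * z u * e (zeroAt u z) m)
        ≈⟨ sum-cong-≋ {N} (λ u → trans (peel (z u) (e (zeroAt u z) m) (e (zeroAt u z) (suc m)))
                                        (*-congˡ (+-congʳ (sym (e-zeroAt z u m))))) ⟩
      ∑[ u < N ] (z u * (e z (suc m) − e (zeroAt u z) (suc m)))
        ≈⟨ sum-cong-≋ {N} (λ u → solve 3 (λ x E A → x :* (E :- A) := E :* x :- x :* A) refl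
                                         (z u) (e z (suc m)) (e (zeroAt u z) (suc m))) ⟩
      ∑[ u < N ] ((e z (suc m) * z u) − (z u * e (zeroAt u z) (suc m)))
        ≈⟨ ∑-distrib-− {N} _ _ ⟩
      (∑[ u < N ] (e z (suc m) * z u)) − (∑[ u < N ] (z u * e (zeroAt u z) (suc m)))
        ≈⟨ +-cong (trans (sym (*-distribˡ-sum {N} (e z (suc m)) z)) (*-comm _ _)) (-‿cong (∑-*-e-zeroAt z (suc m))) ⟩
      (sum z * e z (suc m)) − (fromℕ (suc (suc m)) * e z (suc (suc m))) ∎
      where
      peel : ∀ x a A → x * x * a ≈ x * ((A + x * a) − A)
      peel x a A = solve 3 (λ x a A → x :* x :* a := x :* ((A :+ x :* a) :- A)) refl x a A

    ∑∑-sqˡ-e-zeroAt : ∑[ u < N ] ∑[ v < N ] (z u * z u * e (zeroAt v (zeroAt u z)) m)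
                    ≈ (fromℕ N − fromℕ m) * ∑[ u < N ] (z u * z u * e (zeroAt u z) m)
    ∑∑-sqˡ-e-zeroAt = begin
      ∑[ u < N ] ∑[ v < N ] (z u * z u * e (zeroAt v (zeroAt u z)) m)
        ≈⟨ sum-cong-≋ {N} (λ u → trans (sym (*-distribˡ-sum {N} (z u * z u) _)) (*-congˡ (∑-e-zeroAt-zeroAt u))) ⟩
      ∑[ u < N ] (z u * z u * ((fromℕ N − fromℕ m) * e (zeroAt u z) m))
        ≈⟨ sum-cong-≋ {N} (λ u → x∙yz≈y∙xz (z u * z u) _ _) ⟩
      ∑[ u < N ] ((fromℕ N − fromℕ m) * (z u * z u * e (zeroAt u z) m))
        ≈⟨ sym (*-distribˡ-sum {N} _ _) ⟩
      (fromℕ N − fromℕ m) * ∑[ u < N ] (z u * z u * e (zeroAt u z) m) ∎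
      where
      ∑-e-zeroAt-zeroAt : ∀ u → ∑[ v < N ] e (zeroAt v (zeroAt u z)) m ≈ (fromℕ N − fromℕ m) * e (zeroAt u z) m
      ∑-e-zeroAt-zeroAt u = begin
        X                                  ≈⟨ solve 2 (λ X Y → X := (X :+ Y) :- Y) refl X (fromℕ m * a) ⟩
        (X + fromℕ m * a) − (fromℕ m * a)  ≈⟨ +-congʳ (∑-e-zeroAt (zeroAt u z) m) ⟩
        (fromℕ N * a) − (fromℕ m * a)      ≈⟨ solve 3 (λ q p a → q :* a :- p :* a := (q :- p) :* a) refl (fromℕ N) (fromℕ m) a ⟩
        (fromℕ N − fromℕ m) * a            ∎
        where
        X = ∑[ v < N ] e (zeroAt v (zeroAt u z)) m
        a = e (zeroAt u z) m

    ∑∑-sqʳ-e-zeroAt : ∑[ u < N ] ∑[ v < N ] (z v * z v * e (zeroAt v (zeroAt u z)) m)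
                    ≈ (fromℕ N − fromℕ m) * ∑[ u < N ] (z u * z u * e (zeroAt u z) m)
    ∑∑-sqʳ-e-zeroAt = trans (∑-comm {N} {N} (λ u v → z v * z v * e (zeroAt v (zeroAt u z)) m))
      (trans (sum-cong-≋ {N} λ v → sum-cong-≋ {N} λ u → *-congˡ (e-cong (reflexive ∘ zeroAt-comm u v z) m))
             ∑∑-sqˡ-e-zeroAt)

    ∑∑-cross-e-zeroAt : ∑[ u < N ] ∑[ v < N ] (z u * (z v * e (zeroAt v (zeroAt u z)) m))
                      ≈ fromℕ (suc m) * (fromℕ (suc (suc m)) * e z (suc (suc m))) + ∑[ u < N ] (z u * z u * e (zeroAt u z) m)
    ∑∑-cross-e-zeroAt = begin
      ∑[ u < N ] ∑[ v < N ] (z u * (z v * e (zeroAt v (zeroAt u z)) m))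
        ≈⟨ sum-cong-≋ {N} (λ u → trans (sym (*-distribˡ-sum {N} (z u) _)) (*-congˡ (∑-*-e-zeroAt-zeroAt u))) ⟩
      ∑[ u < N ] (z u * (fromℕ (suc m) * e (zeroAt u z) (suc m) + z u * e (zeroAt u z) m))
        ≈⟨ sum-cong-≋ {N} (λ u → solve 4 (λ x p A B → x :* (p :* A :+ x :* B) := p :* (x :* A) :+ x :* x :* B) refl
                                   (z u) (fromℕ (suc m)) (e (zeroAt u z) (suc m)) (e (zeroAt u z) m)) ⟩
      ∑[ u < N ] (fromℕ (suc m) * (z u * e (zeroAt u z) (suc m)) + z u * z u * e (zeroAt u z) m)
        ≈⟨ ∑-distrib-+ {N} _ _ ⟩
      ∑[ u < N ] (fromℕ (suc m) * (z u * e (zeroAt u z) (suc m))) + ∑[ u < N ] (z u * z u * e (zeroAt u z) m)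
        ≈⟨ +-congʳ (trans (sym (*-distribˡ-sum {N} _ _)) (*-congˡ (∑-*-e-zeroAt z (suc m)))) ⟩
      fromℕ (suc m) * (fromℕ (suc (suc m)) * e z (suc (suc m))) + ∑[ u < N ] (z u * z u * e (zeroAt u z) m) ∎
      where
      -- Split off v = u, where z and zeroAt u z differ.
      ∑-*-e-zeroAt-zeroAt : ∀ u → ∑[ v < N ] (z v * e (zeroAt v (zeroAt u z)) m)
                          ≈ fromℕ (suc m) * e (zeroAt u z) (suc m) + z u * e (zeroAt u z) m
      ∑-*-e-zeroAt-zeroAt u = begin
        ∑[ v < N ] (z v * e (zeroAt v (zeroAt u z)) m)
          ≈⟨ sum-zeroAt u _ ⟩
        ∑[ v < N ] zeroAt u (λ v → z v * e (zeroAt v (zeroAt u z)) m) v + z u * e (zeroAt u (zeroAt u z)) m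
          ≈⟨ +-cong (sum-cong-≋ {N} (λ v → sym (zeroAt-*ˡ u z _ v))) (*-congˡ (e-cong (λ j → reflexive (zeroAt-idem u z j)) m)) ⟩
        ∑[ v < N ] (zeroAt u z v * e (zeroAt v (zeroAt u z)) m) + z u * e (zeroAt u z) m
          ≈⟨ +-congʳ (∑-*-e-zeroAt (zeroAt u z) m) ⟩
        fromℕ (suc m) * e (zeroAt u z) (suc m) + z u * e (zeroAt u z) m ∎

    ∑∑-square-difference : ∑[ u < N ] ∑[ v < N ] (((z u − z v) ^ 2) * e (zeroAt v (zeroAt u z)) m)
      ≈ ((fromℕ 2 * (fromℕ N − fromℕ (suc m))) * (sum z * e z (suc m)))
        − ((fromℕ 2 * fromℕ (suc (suc m)) * fromℕ N) * e z (suc (suc m)))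
    ∑∑-square-difference = begin
      ∑[ u < N ] ∑[ v < N ] (((z u − z v) ^ 2) * E₂ u v)
        ≈⟨ sum-cong-≋ {N} (λ u → sum-cong-≋ {N} (λ v → trans (*-congʳ (^2≈* _)) (expand (z u) (z v) (E₂ u v)))) ⟩
      ∑[ u < N ] ∑[ v < N ] ((z u * z u * E₂ u v + z v * z v * E₂ u v) − (fromℕ 2 * (z u * (z v * E₂ u v))))
        ≈⟨ sum-cong-≋ {N} (λ u → trans (∑-distrib-− {N} _ _)
                                        (+-cong (∑-distrib-+ {N} _ _) (-‿cong (sym (*-distribˡ-sum {N} _ _))))) ⟩
      ∑[ u < N ] ((∑[ v < N ] (z u * z u * E₂ u v) + ∑[ v < N ] (z v * z v * E₂ u v))
                  − (fromℕ 2 * ∑[ v < N ] (z u * (z v * E₂ u v))))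
        ≈⟨ trans (∑-distrib-− {N} _ _) (+-cong (∑-distrib-+ {N} _ _) (-‿cong (sym (*-distribˡ-sum {N} _ _)))) ⟩
      (∑[ u < N ] ∑[ v < N ] (z u * z u * E₂ u v) + ∑[ u < N ] ∑[ v < N ] (z v * z v * E₂ u v))
        − (fromℕ 2 * ∑[ u < N ] ∑[ v < N ] (z u * (z v * E₂ u v)))
        ≈⟨ +-cong (+-cong ∑∑-sqˡ-e-zeroAt ∑∑-sqʳ-e-zeroAt) (-‿cong (*-congˡ ∑∑-cross-e-zeroAt)) ⟩
      ((fromℕ N − fromℕ m) * Q + (fromℕ N − fromℕ m) * Q)
        − (fromℕ 2 * (fromℕ (suc m) * (fromℕ (suc (suc m)) * e z (suc (suc m))) + Q))
        ≈⟨ +-cong (+-cong (*-congˡ ∑-sq-e-zeroAt) (*-congˡ ∑-sq-e-zeroAt))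
                  (-‿cong (*-congˡ (+-cong (*-congʳ (fromℕ-suc m)) ∑-sq-e-zeroAt))) ⟩
      ((fromℕ N − fromℕ m) * ((sum z * e z (suc m)) − (fromℕ (suc (suc m)) * e z (suc (suc m))))
        + (fromℕ N − fromℕ m) * ((sum z * e z (suc m)) − (fromℕ (suc (suc m)) * e z (suc (suc m)))))
        − (fromℕ 2 * ((ι 1ℚ + fromℕ m) * (fromℕ (suc (suc m)) * e z (suc (suc m)))
                      + ((sum z * e z (suc m)) − (fromℕ (suc (suc m)) * e z (suc (suc m))))))
        ≈⟨ solve 6 (λ q p S a r b →
             ((q :- p) :* (S :* a :- r :* b) :+ (q :- p) :* (S :* a :- r :* b))
               :- con (natQ 2) :* ((con 1ℚ :+ p) :* (r :* b) :+ (S :* a :- r :* b))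
             := (con (natQ 2) :* (q :- (con 1ℚ :+ p))) :* (S :* a) :- (con (natQ 2) :* r :* q) :* b)
             refl (fromℕ N) (fromℕ m) (sum z) (e z (suc m)) (fromℕ (suc (suc m))) (e z (suc (suc m))) ⟩
      ((fromℕ 2 * (fromℕ N − (ι 1ℚ + fromℕ m))) * (sum z * e z (suc m)))
        − ((fromℕ 2 * fromℕ (suc (suc m)) * fromℕ N) * e z (suc (suc m)))
        ≈⟨ +-congʳ (*-congʳ (*-congˡ (+-congˡ (-‿cong (sym (fromℕ-suc m)))))) ⟩
      ((fromℕ 2 * (fromℕ N − fromℕ (suc m))) * (sum z * e z (suc m)))
        − ((fromℕ 2 * fromℕ (suc (suc m)) * fromℕ N) * e z (suc (suc m))) ∎
      where
      E₂ : Fin N → Fin N → Carrier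
      E₂ u v = e (zeroAt v (zeroAt u z)) m
      Q : Carrier
      Q = ∑[ u < N ] (z u * z u * e (zeroAt u z) m)
      expand : ∀ x y E → (x − y) * (x − y) * E ≈ (x * x * E + y * y * E) − (fromℕ 2 * (x * (y * E)))
      expand x y E = solve 3 (λ x y E → (x :- y) :* (x :- y) :* E := (x :* x :* E :+ y :* y :* E) :- con (natQ 2) :* (x :* (y :* E)))
                             refl x y E

  -- Sums over subsets

  sumL-cong : ∀ {A : Set} {f g : A → Carrier} (xs : List A) → (∀ x → f x ≈ g x) → sumL (map f xs) ≈ sumL (map g xs)
  sumL-cong []       f≈g = refl
  sumL-cong (x ∷ xs) f≈g = +-cong (f≈g x) (sumL-cong xs f≈g)

  sumL-++ : ∀ {A : Set} (f : A → Carrier) (xs ys : List A) → sumL (map f (xs ++ ys)) ≈ sumL (map f xs) + sumL (map f ys)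
  sumL-++ f []       ys = sym (+-identityˡ _)
  sumL-++ f (x ∷ xs) ys = trans (+-congˡ (sumL-++ f xs ys)) (sym (+-assoc _ _ _))

  sumL-zero : ∀ {A : Set} {f : A → Carrier} (xs : List A) → (∀ x → f x ≈ 0#) → sumL (map f xs) ≈ 0#
  sumL-zero []       f≈0 = refl
  sumL-zero (x ∷ xs) f≈0 = trans (+-cong (f≈0 x) (sumL-zero xs f≈0)) (+-identityˡ 0#)

  *-distribˡ-sumL : ∀ {A : Set} a (f : A → Carrier) (xs : List A) → a * sumL (map f xs) ≈ sumL (map (λ x → a * f x) xs)
  *-distribˡ-sumL a f []       = zeroʳ a
  *-distribˡ-sumL a f (x ∷ xs) = trans (distribˡ a (f x) _) (+-congˡ (*-distribˡ-sumL a f xs))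

  sumL-filter : ∀ {A : Set} {p} {P : A → Set p} (P? : Decidable P) (f : A → Carrier) (xs : List A) →
                sumL (map f (filter P? xs)) ≈ sumL (map (λ x → if does (P? x) then f x else 0#) xs)
  sumL-filter P? f []       = refl
  sumL-filter P? f (x ∷ xs) with does (P? x)
  ... | true  = +-congˡ (sumL-filter P? f xs)
  ... | false = trans (sumL-filter P? f xs) (sym (+-identityˡ _))

  if-cong : ∀ {b b′ x x′} → b ≡ b′ → x ≈ x′ → (if b then x else 0#) ≈ (if b′ then x′ else 0#)
  if-cong {true}  ≡.refl x≈x′ = x≈x′
  if-cong {false} ≡.refl _    = refl

  if-* : ∀ {b b′ x x′ a} → b ≡ b′ → x ≈ a * x′ → (if b then x else 0#) ≈ a * (if b′ then x′ else 0#)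
  if-* {true}  ≡.refl x≈ax′ = x≈ax′
  if-* {false} ≡.refl _     = sym (zeroʳ _)

  if-false : ∀ {b x} → b ≡ false → (if b then x else 0#) ≈ 0#
  if-false ≡.refl = refl

  product-allFin : ∀ {N} (f : Vector Carrier N) → foldr (λ j acc → f j * acc) 1# (allFin N) ≡ product f
  product-allFin f = go f id
    where
    go : ∀ {M N} (f : Vector Carrier N) (g : Fin M → Fin N) → foldr (λ j acc → f j * acc) 1# (tabulate g) ≡ product (f ∘ g)
    go {zero}  f g = ≡.refl
    go {suc M} f g = ≡.cong (f (g zero) *_) (go f (g ∘ suc))

  sumL-allFin : ∀ {N} (f : Vector Carrier N) → sumL (map f (allFin N)) ≡ sum f
  sumL-allFin f = go f id
    where
    go : ∀ {M N} (f : Vector Carrier N) (g : Fin M → Fin N) → sumL (map f (tabulate g)) ≡ sum (f ∘ g)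
    go {zero}  f g = ≡.refl
    go {suc M} f g = ≡.cong (λ s → f (g zero) + s) (go f (g ∘ suc))

  restrict : ∀ {N} → Vector Carrier N → Subset N → Vector Carrier N
  restrict z A j = if lookup A j then z j else 0#

  prodOver-product : ∀ {N} (z : Vector Carrier N) J → prodOver z J ≡ product (λ j → if lookup J j then z j else 1#)
  prodOver-product z J = product-allFin (λ j → if lookup J j then z j else 1#)

  module _ {N} (z : Vector Carrier (suc N)) where

    prodOver-outside : ∀ J → prodOver z (outside ∷ J) ≈ prodOver (tail z) J
    prodOver-outside J = trans (reflexive (prodOver-product z (outside ∷ J)))
                               (trans (*-identityˡ _) (reflexive (≡.sym (prodOver-product (tail z) J))))

    prodOver-inside : ∀ J → prodOver z (inside ∷ J) ≈ head z * prodOver (tail z) J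
    prodOver-inside J = reflexive (≡.trans (prodOver-product z (inside ∷ J)) (≡.cong (head z *_) (≡.sym (prodOver-product (tail z) J))))

  sizedSubsetOf? : ∀ {N} (A : Subset N) (k : ℕ) → Decidable (λ J → J ⊆ A × ∣ J ∣ ≡ k)
  sizedSubsetOf? A k J = (J ⊆? A) ×-dec (∣ J ∣ ℕ.≟ k)

  E-summand : ∀ {N} → Vector Carrier N → Subset N → ℕ → Subset N → Carrier
  E-summand z A k J = if does (sizedSubsetOf? A k J) then prodOver z J else 0#

  module _ {N} (z : Vector Carrier (suc N)) (a : Bool) (A : Subset N) where

    E-summand-outside : ∀ k J → E-summand z (a ∷ A) k (outside ∷ J) ≈ E-summand (tail z) A k J
    E-summand-outside k J =
      if-cong (≡.sym (does-⇔ (out⊆-⇔ ×-⇔ ⇔-id _) (sizedSubsetOf? A k J) (sizedSubsetOf? (a ∷ A) k (outside ∷ J))))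
              (prodOver-outside z J)

    E-summand-inside-zero : ∀ J → E-summand z (a ∷ A) 0 (inside ∷ J) ≈ 0#
    E-summand-inside-zero J = if-false (dec-false (sizedSubsetOf? (a ∷ A) 0 (inside ∷ J)) λ ())

  E-summand-inside-suc : ∀ {N} (z : Vector Carrier (suc N)) a (A : Subset N) k J →
                         E-summand z (a ∷ A) (suc k) (inside ∷ J) ≈ head (restrict z (a ∷ A)) * E-summand (tail z) A k J
  E-summand-inside-suc z outside A k J =
    trans (if-false {x = prodOver z (inside ∷ J)} (dec-false (sizedSubsetOf? (outside ∷ A) (suc k) (inside ∷ J))
                                                             λ (J⊆A , _) → case J⊆A (here {xs = J}) of λ ()))
          (sym (zeroˡ _))
  E-summand-inside-suc z inside A k J =
    if-* (≡.sym (does-⇔ (in⊆in-⇔ ×-⇔ mk⇔ (≡.cong suc) ℕ.suc-injective)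
                        (sizedSubsetOf? A k J) (sizedSubsetOf? (inside ∷ A) (suc k) (inside ∷ J))))
         (prodOver-inside z J)

  sumL-allSubsets-suc : ∀ {N} (f : Subset (suc N) → Carrier) → sumL (map f (allSubsets (suc N)))
                      ≈ sumL (map (f ∘ (outside ∷_)) (allSubsets N)) + sumL (map (f ∘ (inside ∷_)) (allSubsets N))
  sumL-allSubsets-suc {N} f = trans (sumL-++ f (map (outside ∷_) (allSubsets N)) (map (inside ∷_) (allSubsets N)))
    (reflexive (≡.cong₂ _+_ (≡.cong sumL (≡.sym (List.map-∘ (allSubsets N)))) (≡.cong sumL (≡.sym (List.map-∘ (allSubsets N))))))

  sumL-E-summand : ∀ {N} (z : Vector Carrier N) A k → sumL (map (E-summand z A k) (allSubsets N)) ≈ e (restrict z A) k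
  sumL-E-summand {zero}  z [] zero    = +-identityʳ _
  sumL-E-summand {zero}  z [] (suc k) = trans (+-identityʳ _) (if-false {x = prodOver z []} (dec-false (sizedSubsetOf? [] (suc k) []) λ ()))
  sumL-E-summand {suc N} z (a ∷ A) zero = begin
    sumL (map (E-summand z (a ∷ A) 0) (allSubsets (suc N)))
      ≈⟨ sumL-allSubsets-suc (E-summand z (a ∷ A) 0) ⟩
    sumL (map (E-summand z (a ∷ A) 0 ∘ (outside ∷_)) (allSubsets N)) + sumL (map (E-summand z (a ∷ A) 0 ∘ (inside ∷_)) (allSubsets N))
      ≈⟨ +-cong (sumL-cong (allSubsets N) (E-summand-outside z a A 0)) (sumL-zero (allSubsets N) (E-summand-inside-zero z a A)) ⟩
    sumL (map (E-summand (tail z) A 0) (allSubsets N)) + 0#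
      ≈⟨ trans (+-identityʳ _) (sumL-E-summand (tail z) A 0) ⟩
    1# ∎
  sumL-E-summand {suc N} z (a ∷ A) (suc k) = begin
    sumL (map (E-summand z (a ∷ A) (suc k)) (allSubsets (suc N)))
      ≈⟨ sumL-allSubsets-suc (E-summand z (a ∷ A) (suc k)) ⟩
    sumL (map (E-summand z (a ∷ A) (suc k) ∘ (outside ∷_)) (allSubsets N))
      + sumL (map (E-summand z (a ∷ A) (suc k) ∘ (inside ∷_)) (allSubsets N))
      ≈⟨ +-cong (sumL-cong (allSubsets N) (E-summand-outside z a A (suc k))) (sumL-cong (allSubsets N) (E-summand-inside-suc z a A k)) ⟩
    sumL (map (E-summand (tail z) A (suc k)) (allSubsets N))
      + sumL (map (λ J → head (restrict z (a ∷ A)) * E-summand (tail z) A k J) (allSubsets N))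
      ≈⟨ +-cong (sumL-E-summand (tail z) A (suc k))
                (trans (sym (*-distribˡ-sumL _ _ (allSubsets N))) (*-congˡ (sumL-E-summand (tail z) A k))) ⟩
    e (restrict z (a ∷ A)) (suc k) ∎

  E≈e-restrict : ∀ {N} (z : Vector Carrier N) A k → E z A k ≈ e (restrict z A) k
  E≈e-restrict {N} z A k = trans (sumL-filter (sizedSubsetOf? A k) (prodOver z) (allSubsets N)) (sumL-E-summand z A k)

  restrict-⊤ : ∀ {N} (z : Vector Carrier N) j → restrict z ⊤ j ≈ z j
  restrict-⊤ z j rewrite Vec.lookup-replicate j inside = refl

  E-⊤≈e : ∀ {N} (z : Vector Carrier N) k → E z ⊤ k ≈ e z k
  E-⊤≈e z k = trans (E≈e-restrict z ⊤ k) (e-cong (restrict-⊤ z) k)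

  zeroAt-if : ∀ {N} u (w : Vector Carrier N) j → zeroAt u w j ≡ (if lookup ⁅ u ⁆ j then 0# else w j)
  zeroAt-if zero    w zero    = ≡.refl
  zeroAt-if zero    w (suc j) rewrite Vec.lookup-replicate j outside = ≡.refl
  zeroAt-if (suc u) w zero    = ≡.refl
  zeroAt-if (suc u) w (suc j) = zeroAt-if u (tail w) j

  restrict-∁-pair : ∀ {N} (z : Vector Carrier N) u v j → restrict z (∁ (⁅ u ⁆ ∪ ⁅ v ⁆)) j ≈ zeroAt v (zeroAt u z) j
  restrict-∁-pair z u v j
    rewrite Vec.lookup-map j not (⁅ u ⁆ ∪ ⁅ v ⁆) | Vec.lookup-zipWith _∨_ j ⁅ u ⁆ ⁅ v ⁆
          | zeroAt-if v (zeroAt u z) j | zeroAt-if u z j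
    with lookup ⁅ u ⁆ j | lookup ⁅ v ⁆ j
  ... | true  | true  = refl
  ... | true  | false = refl
  ... | false | true  = refl
  ... | false | false = refl

  ∑-sumL : ∀ {A : Set} {N} (g : Fin N → A → Carrier) (xs : List A)
         → ∑[ u < N ] sumL (map (g u) xs) ≈ sumL (map (λ x → ∑[ u < N ] g u x) xs)
  ∑-sumL {N = zero}  g xs = sym (sumL-zero xs λ _ → refl)
  ∑-sumL {N = suc N} g xs = trans (+-congˡ (∑-sumL (g ∘ suc) xs)) (sym (sumL-+ xs))
    where
    sumL-+ : ∀ xs → sumL (map (λ x → g zero x + ∑[ u < N ] g (suc u) x) xs)
                  ≈ sumL (map (g zero) xs) + sumL (map (λ x → ∑[ u < N ] g (suc u) x) xs)
    sumL-+ []       = sym (+-identityˡ 0#)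
    sumL-+ (x ∷ xs) = trans (+-congˡ (sumL-+ xs)) (solve 4 (λ a b c d → (a :+ b) :+ (c :+ d) := (a :+ c) :+ (b :+ d)) refl _ _ _ _)

  sumL-concatMap : ∀ {A B : Set} (f : B → Carrier) (g : A → List B) (xs : List A)
                 → sumL (map f (concatMap g xs)) ≈ sumL (map (λ x → sumL (map f (g x))) xs)
  sumL-concatMap f g []       = refl
  sumL-concatMap f g (x ∷ xs) = trans (sumL-++ f (g x) (concatMap g xs)) (+-congˡ (sumL-concatMap f g xs))

  sumL-offDiagPairs : ∀ {N} (F : Fin N × Fin N → Carrier) → (∀ u → F (u , u) ≈ 0#)
                    → sumL (map F (offDiagPairs N)) ≈ ∑[ u < N ] ∑[ v < N ] F (u , v)
  sumL-offDiagPairs {N} F F-diag = begin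
    sumL (map F (offDiagPairs N))
      ≈⟨ sumL-filter (λ p → ¬? (proj₁ p Fin.≟ proj₂ p)) F (concatMap row (allFin N)) ⟩
    sumL (map (λ p → if does (¬? (proj₁ p Fin.≟ proj₂ p)) then F p else 0#) (concatMap row (allFin N)))
      ≈⟨ sumL-cong (concatMap row (allFin N)) off-diagonal ⟩
    sumL (map F (concatMap row (allFin N)))
      ≈⟨ sumL-concatMap F row (allFin N) ⟩
    sumL (map (λ u → sumL (map F (row u))) (allFin N))
      ≡⟨ sumL-allFin (λ u → sumL (map F (row u))) ⟩
    ∑[ u < N ] sumL (map F (row u))
      ≡⟨ sum-cong-≗ {N} (λ u → ≡.trans (≡.cong sumL (≡.sym (List.map-∘ (allFin N)))) (sumL-allFin (λ v → F (u , v)))) ⟩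
    ∑[ u < N ] ∑[ v < N ] F (u , v) ∎
    where
    row : Fin N → List (Fin N × Fin N)
    row u = map (u ,_) (allFin N)
    off-diagonal : ∀ p → (if does (¬? (proj₁ p Fin.≟ proj₂ p)) then F p else 0#) ≈ F p
    off-diagonal (u , v) with u Fin.≟ v
    ... | yes ≡.refl = sym (F-diag u)
    ... | no _       = refl

  sumL-applyUpTo-cong : ∀ {f g : ℕ → Carrier} m → (∀ i → i < m → f i ≈ g i) → sumL (applyUpTo f m) ≈ sumL (applyUpTo g m)
  sumL-applyUpTo-cong zero    f≈g = refl
  sumL-applyUpTo-cong (suc m) f≈g = +-cong (f≈g 0 (s≤s z≤n)) (sumL-applyUpTo-cong m (λ i i<m → f≈g (suc i) (s≤s i<m)))

  sumL-telescope : ∀ (t : ℕ → Carrier) m → sumL (applyUpTo (λ i → t i − t (suc i)) m) ≈ t 0 − t m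
  sumL-telescope t zero    = sym (-‿inverseʳ (t 0))
  sumL-telescope t (suc m) = trans (+-congˡ (sumL-telescope (t ∘ suc) m))
    (solve 3 (λ a b c → (a :- b) :+ (b :- c) := a :- c) refl (t 0) (t 1) (t (suc m)))

  fromℕ-∸ : ∀ {m n} → m ≤ n → fromℕ (n ∸ m) ≈ fromℕ n − fromℕ m
  fromℕ-∸ {m} {n} m≤n = begin
    fromℕ (n ∸ m)                              ≈⟨ solve 2 (λ d p → d := (p :+ d) :- p) refl (fromℕ (n ∸ m)) (fromℕ m) ⟩
    (fromℕ m + fromℕ (n ∸ m)) − fromℕ m        ≈⟨ +-congʳ (sym (fromℕ-+ m (n ∸ m))) ⟩
    fromℕ (m +ℕ (n ∸ m)) − fromℕ m             ≈⟨ +-congʳ (reflexive (≡.cong fromℕ (ℕ.m+[n∸m]≡n m≤n))) ⟩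
    fromℕ n − fromℕ m                          ∎

  recip-*-recip-*-fromℕ : ∀ {a b x d} → 1 ≤ a → 1 ≤ b → 1 ≤ d → a *ℕ b ≡ x *ℕ d
                        → (recip a * recip b) * fromℕ x ≈ recip d
  recip-*-recip-*-fromℕ {x = x} 1≤a 1≤b 1≤d ab≡xd =
    trans (*-congʳ (sym (recip-* 1≤a 1≤b))) (recip-*-fromℕ-cancel {b = x} (ℕ.*-mono-≤ 1≤a 1≤b) 1≤d ab≡xd)

  -- Telescoping

  pair-coefficient-lower : ∀ {N} m → suc (suc m) ≤ N
    → (recip (2 *ℕ N) * recip (suc (suc m) *ℕ (N C suc (suc m)))) * (fromℕ (2 *ℕ (N ∸ suc m)) * fromℕ N) ≈ recip (N C suc m)
  pair-coefficient-lower {N} m k≤N = trans (*-congˡ (sym (fromℕ-* (2 *ℕ (N ∸ suc m)) N)))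
    (recip-*-recip-*-fromℕ {2 *ℕ N} {suc (suc m) *ℕ (N C suc (suc m))} {2 *ℕ (N ∸ suc m) *ℕ N} {N C suc m}
      (ℕ.*-mono-≤ (s≤s (z≤n {1})) 1≤N) (ℕ.*-mono-≤ (s≤s (z≤n {suc m})) (C-pos k≤N)) (C-pos (ℕ.<⇒≤ k≤N))
      2N*kCk≡2[N∸k+1]N*Ck-1)
    where
    reorder : ∀ N r c → 2 *ℕ N *ℕ (r *ℕ c) ≡ 2 *ℕ r *ℕ N *ℕ c
    reorder = solve-∀
    2N*kCk≡2[N∸k+1]N*Ck-1 : 2 *ℕ N *ℕ (suc (suc m) *ℕ (N C suc (suc m))) ≡ 2 *ℕ (N ∸ suc m) *ℕ N *ℕ (N C suc m)
    2N*kCk≡2[N∸k+1]N*Ck-1 = ≡.trans (≡.cong (λ x → 2 *ℕ N *ℕ x) (C-absorption N (suc m))) (reorder N (N ∸ suc m) (N C suc m))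
    1≤N = ℕ.≤-trans (s≤s z≤n) k≤N

  pair-coefficient-upper : ∀ {N} k → 1 ≤ k → k ≤ N
    → (recip (2 *ℕ N) * recip (k *ℕ (N C k))) * ((fromℕ 2 * fromℕ k) * fromℕ N) ≈ recip (N C k)
  pair-coefficient-upper {N} k 1≤k k≤N = trans (*-congˡ (sym (trans (fromℕ-* (2 *ℕ k) N) (*-congʳ (fromℕ-* 2 k)))))
    (recip-*-recip-*-fromℕ {2 *ℕ N} {k *ℕ (N C k)} {2 *ℕ k *ℕ N} {N C k}
      (ℕ.*-mono-≤ (s≤s (z≤n {1})) (ℕ.≤-trans 1≤k k≤N)) (ℕ.*-mono-≤ 1≤k (C-pos k≤N)) (C-pos k≤N) (reorder N k (N C k)))
    where
    reorder : ∀ N k c → 2 *ℕ N *ℕ (k *ℕ c) ≡ 2 *ℕ k *ℕ N *ℕ c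
    reorder = solve-∀

  module _ {N} (z : Vector Carrier N) where

    z̃ : Carrier
    z̃ = recip N * sumL (map z (allFin N))

    sum≈N*z̃ : 1 ≤ N → sum z ≈ fromℕ N * z̃
    sum≈N*z̃ 1≤N = begin
      sum z                            ≈⟨ sym (*-identityˡ _) ⟩
      1# * sum z                       ≈⟨ *-congʳ (sym (recip-*-fromℕ 1≤N)) ⟩
      (recip N * fromℕ N) * sum z      ≈⟨ solve 3 (λ r q s → (r :* q) :* s := q :* (r :* s)) refl (recip N) (fromℕ N) (sum z) ⟩
      fromℕ N * (recip N * sum z)      ≈⟨ *-congˡ (*-congˡ (reflexive (≡.sym (sumL-allFin z)))) ⟩
      fromℕ N * z̃                      ∎

    module _ (n : ℕ) where

      T : ℕ → Carrier
      T j = (recip (N C j) * (z̃ ^ (n ∸ j))) * e z j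

      pairTerm : ℕ → Fin N → Fin N → Carrier
      pairTerm k u v = (recip (k *ℕ (N C k)) * (z̃ ^ (n ∸ k))) * E z (∁ (⁅ u ⁆ ∪ ⁅ v ⁆)) (k ∸ 2)

      T-1≈z̃^n : 1 ≤ n → T 1 ≈ (z̃ ^ n)
      T-1≈z̃^n (s≤s {n = n′} _) = begin
        (recip (N C 1) * (z̃ ^ n′)) * e z 1       ≈⟨ *-cong (*-congʳ (reflexive (≡.cong recip (nC1≡n N)))) (e-1 z) ⟩
        (recip N * (z̃ ^ n′)) * sum z             ≈⟨ *-congˡ (reflexive (≡.sym (sumL-allFin z))) ⟩
        (recip N * (z̃ ^ n′)) * sumL (map z (allFin N))
          ≈⟨ solve 3 (λ r Z s → (r :* Z) :* s := (r :* s) :* Z) refl (recip N) (z̃ ^ n′) (sumL (map z (allFin N))) ⟩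
        z̃ * (z̃ ^ n′)                             ∎

      T-n≈E : T n ≈ recip (N C n) * E z ⊤ n
      T-n≈E = begin
        (recip (N C n) * (z̃ ^ (n ∸ n))) * e z n  ≈⟨ *-congʳ (*-congˡ (reflexive (≡.cong (z̃ ^_) (ℕ.n∸n≡0 n)))) ⟩
        (recip (N C n) * 1#) * e z n              ≈⟨ *-cong (*-identityʳ _) (sym (E-⊤≈e z n)) ⟩
        recip (N C n) * E z ⊤ n                   ∎

      ∑∑-pairTerm : ∀ m → ∑[ u < N ] ∑[ v < N ] (((z u − z v) ^ 2) * pairTerm (suc (suc m)) u v)
                  ≈ (recip (suc (suc m) *ℕ (N C suc (suc m))) * (z̃ ^ (n ∸ suc (suc m))))
                    * ∑[ u < N ] ∑[ v < N ] (((z u − z v) ^ 2) * e (zeroAt v (zeroAt u z)) m)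
      ∑∑-pairTerm m = trans (sum-cong-≋ {N} λ u → sum-cong-≋ {N} λ v → trans
                               (*-congˡ (*-congˡ (trans (E≈e-restrict z _ m) (e-cong (restrict-∁-pair z u v) m))))
                               (x∙yz≈y∙xz _ _ _))
                            (trans (sum-cong-≋ {N} λ u → sym (*-distribˡ-sum {N} _ _)) (sym (*-distribˡ-sum {N} _ _)))

      T-step : ∀ m → suc (suc m) ≤ n → n ≤ N
        → recip (2 *ℕ N) * ∑[ u < N ] ∑[ v < N ] (((z u − z v) ^ 2) * pairTerm (suc (suc m)) u v)
          ≈ T (suc m) − T (suc (suc m))
      T-step m k≤n n≤N = begin
        r * ∑[ u < N ] ∑[ v < N ] (((z u − z v) ^ 2) * pairTerm k u v)
          ≈⟨ *-congˡ (trans (∑∑-pairTerm m) (*-congˡ (∑∑-square-difference z m))) ⟩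
        r * ((c * Z) * (((fromℕ 2 * (fromℕ N − fromℕ (suc m))) * (sum z * e₁)) − (B * e₂)))
          ≈⟨ *-congˡ (*-congˡ (+-congʳ (*-cong (trans (*-congˡ (sym (fromℕ-∸ sm≤N))) (sym (fromℕ-* 2 (N ∸ suc m))))
                                                (*-congʳ (sum≈N*z̃ (ℕ.≤-trans (s≤s z≤n) sm≤N)))))) ⟩
        r * ((c * Z) * ((A * ((fromℕ N * z̃) * e₁)) − (B * e₂)))
          ≈⟨ solve 9 (λ r c Z A q z̃ e₁ B e₂ →
                   r :* ((c :* Z) :* ((A :* ((q :* z̃) :* e₁)) :- (B :* e₂)))
                := ((r :* c) :* (A :* q)) :* ((z̃ :* Z) :* e₁) :- ((r :* c) :* B) :* (Z :* e₂))
                refl r c Z A (fromℕ N) z̃ e₁ B e₂ ⟩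
        (((r * c) * (A * fromℕ N)) * ((z̃ * Z) * e₁)) − (((r * c) * B) * (Z * e₂))
          ≈⟨ +-cong (*-cong (pair-coefficient-lower m (ℕ.≤-trans k≤n n≤N))
                            (*-congʳ (reflexive (≡.cong (z̃ ^_) (≡.sym (ℕ.+-∸-assoc 1 k≤n))))))
                    (-‿cong (*-congʳ (pair-coefficient-upper k (s≤s z≤n) (ℕ.≤-trans k≤n n≤N)))) ⟩
        (recip (N C suc m) * ((z̃ ^ (n ∸ suc m)) * e₁)) − (recip (N C k) * (Z * e₂))
          ≈⟨ +-cong (sym (*-assoc _ _ _)) (-‿cong (sym (*-assoc _ _ _))) ⟩
        T (suc m) − T k ∎
        where
        k = suc (suc m)
        r = recip (2 *ℕ N)
        c = recip (k *ℕ (N C k))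
        Z = z̃ ^ (n ∸ k)
        A = fromℕ (2 *ℕ (N ∸ suc m))
        B = (fromℕ 2 * fromℕ k) * fromℕ N
        e₁ = e z (suc m)
        e₂ = e z k
        sm≤N : suc m ≤ N
        sm≤N = ℕ.<⇒≤ (ℕ.≤-trans k≤n n≤N)

      pair-sum-telescopes : ∀ {n′} → n ≡ suc n′ → n ≤ N → (F : Fin N × Fin N → Carrier)
        → (∀ u v → F (u , v) ≡ ((z u − z v) ^ 2) * sumL (map (λ k → pairTerm k u v) (rangeFromTo 2 n)))
        → recip (2 *ℕ N) * sumL (map F (offDiagPairs N)) ≈ T 1 − T n
      pair-sum-telescopes {n′} ≡.refl n≤N F F≡ = begin
        recip (2 *ℕ N) * sumL (map F (offDiagPairs N))
          ≈⟨ *-congˡ (sumL-offDiagPairs F F-diag) ⟩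
        recip (2 *ℕ N) * ∑[ u < N ] ∑[ v < N ] F (u , v)
          ≈⟨ *-congˡ (sum-cong-≋ {N} λ u → sum-cong-≋ {N} λ v → trans (reflexive (F≡ u v)) (*-distribˡ-sumL _ _ ks)) ⟩
        recip (2 *ℕ N) * ∑[ u < N ] ∑[ v < N ] sumL (map (λ k → ((z u − z v) ^ 2) * pairTerm k u v) ks)
          ≈⟨ *-congˡ (trans (sum-cong-≋ {N} λ u → ∑-sumL {N = N} _ ks) (∑-sumL {N = N} _ ks)) ⟩
        recip (2 *ℕ N) * sumL (map (λ k → ∑[ u < N ] ∑[ v < N ] (((z u − z v) ^ 2) * pairTerm k u v)) ks)
          ≈⟨ *-distribˡ-sumL _ _ ks ⟩
        sumL (map H ks)
          ≡⟨ ≡.cong sumL (≡.trans (≡.sym (List.map-∘ (applyUpTo id n′))) (List.map-applyUpTo id (λ i → H (i +ℕ 2)) n′)) ⟩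
        sumL (applyUpTo (λ i → H (i +ℕ 2)) n′)
          ≈⟨ sumL-applyUpTo-cong n′ (λ i i<n′ → trans (reflexive (≡.cong H (ℕ.+-comm i 2))) (T-step i (s≤s i<n′) n≤N)) ⟩
        sumL (applyUpTo (λ i → T (suc i) − T (suc (suc i))) n′)
          ≈⟨ sumL-telescope (T ∘ suc) n′ ⟩
        T 1 − T n ∎
        where
        ks = rangeFromTo 2 n
        H : ℕ → Carrier
        H k = recip (2 *ℕ N) * ∑[ u < N ] ∑[ v < N ] (((z u − z v) ^ 2) * pairTerm k u v)
        F-diag : ∀ u → F (u , u) ≈ 0#
        F-diag u = trans (reflexive (F≡ u u)) (trans (*-congʳ (^2≈* _))
          (trans (solve 2 (λ x X → (x :- x) :* (x :- x) :* X := con 0ℚ) refl (z u) (sumL (map (λ k → pairTerm k u u) ks))) ι.0#-homo))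

      -- rangeFromTo 2 n only reduces to a shifted upTo once n is a successor.
      E-deviation : ∀ {n′} → n ≡ suc n′ → n ≤ N → (F : Fin N × Fin N → Carrier)
        → (∀ u v → F (u , v) ≡ ((z u − z v) ^ 2) * sumL (map (λ k → pairTerm k u v) (rangeFromTo 2 n)))
        → (recip (N C n) * E z ⊤ n) − (z̃ ^ n) ≈ - (recip (2 *ℕ N) * sumL (map F (offDiagPairs N)))
      E-deviation n≡1+n′ n≤N F F≡ = begin
        (recip (N C n) * E z ⊤ n) − (z̃ ^ n)  ≈⟨ +-cong (sym T-n≈E) (-‿cong (sym (T-1≈z̃^n 1≤n))) ⟩
        T n − T 1                             ≈⟨ solve 2 (λ a b → a :- b := :- (b :- a)) refl (T n) (T 1) ⟩
        - (T 1 − T n)                         ≈⟨ -‿cong (sym (pair-sum-telescopes n≡1+n′ n≤N F F≡)) ⟩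
        - (recip (2 *ℕ N) * sumL (map F (offDiagPairs N))) ∎
        where
        1≤n : 1 ≤ n
        1≤n = ≡.subst (1 ≤_) (≡.sym n≡1+n′) (s≤s z≤n)

  prodAll≈E : ∀ {N} (z : Vector Carrier N) → prodAll z ≈ recip (N C N) * E z ⊤ N
  prodAll≈E {N} z = begin
    prodAll z                 ≡⟨ product-allFin z ⟩
    product z                 ≈⟨ sym (e-top z) ⟩
    e z N                     ≈⟨ sym (E-⊤≈e z N) ⟩
    E z ⊤ N                   ≈⟨ sym (*-identityˡ _) ⟩
    1# * E z ⊤ N              ≈⟨ *-congʳ (sym (trans (reflexive (≡.cong recip (nCn≡1 N))) ι.1#-homo)) ⟩
    recip (N C N) * E z ⊤ N   ∎

corollary3p8 : ∀ {c ℓ} (R : CommutativeRing c ℓ) (ι : ℚ → CommutativeRing.Carrier R)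
  → IsRingHomomorphism (CommutativeRing.rawRing +-*-commutativeRing) (CommutativeRing.rawRing R) ι
  → let open CommutativeRing R
        open Ops R
    in ((N n : ℕ) → 1 ≤ n → n ≤ N → (z : Fin N → Carrier)
        → let zt = ι (inv N) * sumL (map z (allFin N))
          in (ι (inv (N C n)) * E z ⊤ n) − (zt ^ n)
             ≈ - (ι (inv (2 *ℕ N)) * sumL (map (λ { (u , v) → ((z u − z v) ^ 2)
                    * sumL (map (λ k → (ι (inv (k *ℕ (N C k))) * (zt ^ (n ∸ k)))
                                        * E z (∁ (⁅ u ⁆ ∪ ⁅ v ⁆)) (k ∸ 2))
                                (rangeFromTo 2 n)) })
                  (offDiagPairs N))))
       × ((n : ℕ) → 1 ≤ n → (z : Fin n → Carrier)
        → let zt = ι (inv n) * sumL (map z (allFin n))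
          in prodAll z − (zt ^ n)
             ≈ - (ι (inv (2 *ℕ n)) * sumL (map (λ { (u , v) → ((z u − z v) ^ 2)
                    * sumL (map (λ k → (ι (inv (k *ℕ (n C k))) * (zt ^ (n ∸ k)))
                                        * E z (∁ (⁅ u ⁆ ∪ ⁅ v ⁆)) (k ∸ 2))
                                (rangeFromTo 2 n)) })
                  (offDiagPairs n))))
corollary3p8 R ι ι-hom =
  (λ { N (suc n′) _ n≤N z → E-deviation z (suc n′) ≡.refl n≤N _ (λ u v → ≡.refl) }) ,
  (λ { (suc n′) _ z → trans (+-congʳ (prodAll≈E z)) (E-deviation z (suc n′) ≡.refl ℕ.≤-refl _ (λ u v → ≡.refl)) })
  -- The pair summand in the statement is a pattern-matching lambda, equal to the one used
  -- here only up to ≡ on pairs; hence the F argument of E-deviation.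
  where
  open QAlgebra R ι ι-hom
  open CommutativeRing R using (trans; +-congʳ)
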